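{- Let $\Sigma$ be the relational signature (without equality) consisting of a unary predicate $P$ and binary predicates $Q,R$, and let $T$ be the coherent theory with single axiom $\forall x,z.\,\big(P(x)\to(Q(x,z)\lor R(x,z))\big)$. Let \[\phi := \exists x,y.\,\big(P(x)\land P(y)\land \neg\forall z.\,(Q(x,z)\lor R(y,z))\big).\] Then every condition forces $\neg\phi$ in the forcing relation $\Vdash_{\mathrm{vs}}$ on $\mathbb{C}_{\mathrm{vs}}$, and every condition forces $\neg\neg\phi$ in the forcing relation $\Vdash_{\mathrm{rn}}$ on $\mathbb{C}_{\mathrm{rn}}$ (both with respect to the coverage $\lhd_T$).
   Context: Fix a countably infinite set of variables. For a set $X$ of variables, $\mathrm{Tm}(X)$ denotes the set of terms over $X$ (here just the variables, since $\Sigma$ is relational). A condition is a pair $(X;A)$ with $X$ a finite set of variables and $A$ a finite set of atoms whose variables lie in $X$; $(X,\vec x;A,\psi)$ denotes the condition obtained by adding fresh variables $\vec x$ and the atoms of the conjunction $\psi$. Substitutions act postfix. $\mathbb{C}_{\mathrm{vs}}$ is the category of conditions with morphisms $f:(Y;B)\to(X;A)$ the functions $f:X\to Y$ with $Af\subseteq B$; $\mathbb{C}_{\mathrm{rn}}$ is the subcategory of injective such $f$. The relation $C\lhd_T U$ (also written $U\rhd C$) between a condition $C$ and a set $U$ of morphisms with codomain $C$ is inductively generated by: (a) $(X;A)\lhd_T\{f\}$ for every isomorphism $f$ with codomain $(X;A)$; (b) if $\phi_0\to\exists\vec x_1.\phi_1\lor\dots\lor\exists\vec x_n.\phi_n$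 is an instance of an axiom of $T$ obtained by substituting terms of $\mathrm{Tm}(X)$ for its universally quantified variables, with the atoms of $\phi_0$ in $A$, the bound $\vec x_i$ fresh for $X$, and $(X,\vec x_i;A,\phi_i)\lhd_T U_i$ for $i=1,\dots,n$, then $(X;A)\lhd_T\bigcup_i e_iU_i$, where $e_i:(X,\vec x_i;A,\phi_i)\to(X;A)$ is the identity on $X$ and $e_iU_i=\{e_i\circ g\mid g\in U_i\}$. Forcing $C\Vdash\psi$ (for $C=(X;A)$, $\psi$ with free variables in $X$) in a category $\mathbb{C}$ of conditions is defined by: $C\Vdash\top$ always; $C\Vdash\bot$ iff $C\lhd_T\emptyset$; for an atom $\psi$, $C\Vdash\psi$ iff there is $U\rhd C$ with $\psi f\in\mathrm{Fact}(D)$ (the atom set of $D$) for all $f:D\to C$ in $U$; $C\Vdash\bigwedge_i\psi_i$ iff $C\Vdash\psi_i$ for all $i$; $C\Vdash\bigvee_i\psi_i$ iff there is $U\rhd C$ such that for every $f:D\to C$ in $U$, $D\Vdash\psi_if$ for some $i$; $C\Vdash\psi_1\to\psi_2$ iff for all $f:D\to C$ in $\mathbb{C}$, $D\Vdash\psi_1f$ implies $D\Vdash\psi_2f$; $C\Vdash\forall x.\psi$ iff for all $f:D\to C$ and all $t\in\mathrm{Tm}(D)$, $D\Vdash\psi[f,x:=t]$; $C\Vdash\exists x.\psi$ iff there is $U\rhd C$ such that for every $f:D\to C$ in $U$ there is $t\in\mathrm{Tm}(D)$ with $D\Vdash\psi[f,x:=t]$. Here $\neg\psi$ abbreviates $\psi\to\bot$.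 $\Vdash_{\mathrm{vs}}$ and $\Vdash_{\mathrm{rn}}$ are this relation for $\mathbb{C}=\mathbb{C}_{\mathrm{vs}}$ and $\mathbb{C}=\mathbb{C}_{\mathrm{rn}}$ respectively. -}

module Defs where

open import Data.Nat using (ℕ; suc)
open import Data.Fin using (Fin; zero; suc)
open import Data.List using (List; _∷_)
open import Data.List.Membership.Propositional using (_∈_)
open import Data.List.Relation.Unary.Any using (here; there)
open import Data.List.Relation.Unary.All using (All; _∷_)
open import Data.Product using (Σ; _×_; _,_)
open import Data.Sum using (_⊎_)
open import Data.Unit using (⊤)
open import Data.Empty using (⊥)
open import Function using (_∘_; id)
open import Relation.Binary.PropositionalEquality using (_≡_; refl; subst; sym)

data Atom (V : Set) : Set where
  P : V → Atom V
  Q : V → V → Atom V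
  R : V → V → Atom V

mapAtom : {V W : Set} → (V → W) → Atom V → Atom W
mapAtom f (P x)   = P (f x)
mapAtom f (Q x z) = Q (f x) (f z)
mapAtom f (R x z) = R (f x) (f z)

mapAtom-id : {V : Set} (a : Atom V) → mapAtom id a ≡ a
mapAtom-id (P x)   = refl
mapAtom-id (Q x z) = refl
mapAtom-id (R x z) = refl

mapAtom-∘ : {U V W : Set} (g : V → W) (f : U → V) (a : Atom U) →
            mapAtom (g ∘ f) a ≡ mapAtom g (mapAtom f a)
mapAtom-∘ g f (P x)   = refl
mapAtom-∘ g f (Q x z) = refl
mapAtom-∘ g f (R x z) = refl

VarsIn : Atom ℕ → List ℕ → Set
VarsIn (P x)   X = x ∈ X
VarsIn (Q x z) X = x ∈ X × z ∈ X
VarsIn (R x z) X = x ∈ X × z ∈ X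

record Cond : Set where
  constructor cond
  field
    vars  : List ℕ
    facts : List (Atom ℕ)
    wf    : All (λ a → VarsIn a vars) facts
open Cond public

-- Morphisms f : D → C, D = (Y;B), C = (X;A): functions X → Y with A f ⊆ B.
-- (represented by a function ℕ → ℕ; only its restriction to X matters)
record Hom (D C : Cond) : Set where
  constructor hom
  field
    fun       : ℕ → ℕ
    mapsVars  : ∀ {x} → x ∈ vars C → fun x ∈ vars D
    mapsFacts : ∀ {a} → a ∈ facts C → mapAtom fun a ∈ facts D
open Hom public

-- composition  f ∘ g : E → C  for  f : D → C, g : E → D  (postfix action: x ↦ (x f) g)
compH : {C D E : Cond} → Hom D C → Hom E D → Hom E C
compH {C} {D} {E} f g = hom (fun g ∘ fun f)
                (mapsVars g ∘ mapsVars f)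
                (λ {a} m → subst (_∈ facts E) (sym (mapAtom-∘ (fun g) (fun f) a))
                                  (mapsFacts g (mapsFacts f m)))

IsIso : {D C : Cond} → Hom D C → Set
IsIso {D} {C} f = Σ (Hom C D) λ g →
    (∀ {x} → x ∈ vars C → fun g (fun f x) ≡ x)
  × (∀ {y} → y ∈ vars D → fun f (fun g y) ≡ y)

addFact : (C : Cond) (a : Atom ℕ) → VarsIn a (vars C) → Cond
addFact C a p = cond (vars C) (a ∷ facts C) (p ∷ wf C)

incl : {C : Cond} {a : Atom ℕ} {p : VarsIn a (vars C)} → Hom (addFact C a p) C
incl {C} = hom id id (λ {b} m → there (subst (_∈ facts C) (sym (mapAtom-id b)) m))

-- A derivation of C ◁_T U is a tree; U is the set of its leaves
-- (composed with the inclusions e_i along the path).  Rule (b) is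
-- specialised to the unique axiom of T: an instance with x := a,
-- z := b (a, b ∈ Tm(X) = X), P(a) ∈ A, no bound variables, n = 2.

data Cover : Cond → Set where
  leaf  : {C : Cond} (D : Cond) (f : Hom D C) → IsIso f → Cover C
  split : {C : Cond} (a b : ℕ) → P a ∈ facts C →
          (ax : a ∈ vars C) (bx : b ∈ vars C) →
          Cover (addFact C (Q a b) (ax , bx)) →
          Cover (addFact C (R a b) (ax , bx)) → Cover C

AllIn : {C : Cond} → Cover C → ((D : Cond) → Hom D C → Set) → Set
AllIn (leaf D f _) Φ = Φ D f
AllIn {C} (split a b _ ax bx c₁ c₂) Φ =
    AllIn c₁ (λ D g → Φ D (compH (incl {C} {Q a b} {ax , bx}) g))
  × AllIn c₂ (λ D g → Φ D (compH (incl {C} {R a b} {ax , bx}) g))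

-- Formulas over Σ, de Bruijn style: Fm n has free variables Fin n.
-- A formula ψ with free variables in X is represented as (ψ , ρ) with
-- ρ : Fin n → ℕ; the substitution ψ f is (ψ , fun f ∘ ρ).

data Fm : ℕ → Set where
  ⊤'   : {n : ℕ} → Fm n
  ⊥'   : {n : ℕ} → Fm n
  atom : {n : ℕ} → Atom (Fin n) → Fm n
  _∧'_ : {n : ℕ} → Fm n → Fm n → Fm n
  _∨'_ : {n : ℕ} → Fm n → Fm n → Fm n
  _⇒_  : {n : ℕ} → Fm n → Fm n → Fm n
  ∀'   : {n : ℕ} → Fm (suc n) → Fm n
  ∃'   : {n : ℕ} → Fm (suc n) → Fm n

¬' : {n : ℕ} → Fm n → Fm n
¬' ψ = ψ ⇒ ⊥'

ext : {n : ℕ} → ℕ → (Fin n → ℕ) → Fin (suc n) → ℕ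
ext t ρ zero    = t
ext t ρ (suc i) = ρ i

-- Forcing in a category of conditions given by an admissibility
-- predicate on morphisms (the subcategory of C_vs).

Forces : (Adm : {D C : Cond} → Hom D C → Set) →
         {n : ℕ} → Cond → Fm n → (Fin n → ℕ) → Set
Forces Adm C ⊤' ρ = ⊤
Forces Adm C ⊥' ρ = Σ (Cover C) λ c → AllIn c (λ D f → ⊥)
Forces Adm C (atom a) ρ =
  Σ (Cover C) λ c → AllIn c (λ D f → mapAtom (fun f ∘ ρ) a ∈ facts D)
Forces Adm C (ψ₁ ∧' ψ₂) ρ = Forces Adm C ψ₁ ρ × Forces Adm C ψ₂ ρ
Forces Adm C (ψ₁ ∨' ψ₂) ρ =
  Σ (Cover C) λ c → AllIn c (λ D f →
    Forces Adm D ψ₁ (fun f ∘ ρ) ⊎ Forces Adm D ψ₂ (fun f ∘ ρ))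
Forces Adm C (ψ₁ ⇒ ψ₂) ρ =
  (D : Cond) (f : Hom D C) → Adm f →
    Forces Adm D ψ₁ (fun f ∘ ρ) → Forces Adm D ψ₂ (fun f ∘ ρ)
Forces Adm C (∀' ψ) ρ =
  (D : Cond) (f : Hom D C) → Adm f →
    (t : ℕ) → t ∈ vars D → Forces Adm D ψ (ext t (fun f ∘ ρ))
Forces Adm C (∃' ψ) ρ =
  Σ (Cover C) λ c → AllIn c (λ D f →
    Σ ℕ λ t → t ∈ vars D × Forces Adm D ψ (ext t (fun f ∘ ρ)))

Adm-vs : {D C : Cond} → Hom D C → Set
Adm-vs f = ⊤

Adm-rn : {D C : Cond} → Hom D C → Set
Adm-rn {D} {C} f = ∀ {x y} → x ∈ vars C → y ∈ vars C → fun f x ≡ fun f y → x ≡ y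

_⊩vs_ : Cond → Fm 0 → Set
C ⊩vs ψ = Forces Adm-vs C ψ (λ ())

_⊩rn_ : Cond → Fm 0 → Set
C ⊩rn ψ = Forces Adm-rn C ψ (λ ())

-- φ := ∃x,y. P(x) ∧ P(y) ∧ ¬ ∀z. (Q(x,z) ∨ R(y,z))
-- under ∃x∃y: x = 1, y = 0;  under ∀z additionally: z = 0, y = 1, x = 2.

φ : Fm 0
φ = ∃' (∃' (atom (P (suc zero)) ∧'
            (atom (P zero) ∧'
             ¬' (∀' (atom (Q (suc (suc zero)) zero) ∨' atom (R (suc zero) zero))))))

module Submission where

-- Then two coverage facts: every
-- cover has a leaf, so no condition forces ⊥; and if P(u) is a fact then
-- ∀z. Q(u,z) ∨ R(u,z) is forced, each instance being covered by an axiom split.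
--
-- C_vs.  If a condition forced φ, some leaf F has witnesses x, y and forces
-- ¬∀z.(Q(x,z) ∨ R(y,z)).  Renaming y to x (a non-injective morphism, allowed in
-- C_vs) and adding P(x) yields a condition forcing ∀z.(Q(x,z) ∨ R(x,z)), hence ⊥.
--
-- C_rn.  Injective morphisms keep x ≠ y apart.  For a fresh variable c the pair of
-- atoms Q(x,c), R(y,c) stays "undecided" along every cover: an axiom split can
-- only add one of them, and then the other branch avoids both.  So ∀z.(Q(x,z) ∨
-- R(y,z)) is never forced when x ≠ y, and any condition extended by two distinct
-- P-variables forces φ; this refutes every extension forcing ¬φ.

open import Defs
open import Data.Nat using (ℕ; zero; suc; _≟_)
open import Data.Nat.Properties using (1+n≰n)
open import Data.Fin using (Fin; zero; suc)
open import Data.List using (List; _∷_; map)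
open import Data.List.Extrema.Nat using (max; xs≤max)
open import Data.List.Membership.Propositional using (_∈_; _∉_)
open import Data.List.Membership.Propositional.Properties using (∈-map⁺)
open import Data.List.Relation.Unary.Any using (here; there)
open import Data.List.Relation.Unary.All as All using (_∷_)
open import Data.List.Relation.Unary.All.Properties using (map⁺)
open import Data.Product using (Σ; _×_; _,_; proj₂)
open import Data.Sum using (inj₁; inj₂)
open import Data.Unit using (tt)
open import Data.Empty using (⊥; ⊥-elim)
open import Function using (_∘_; id)
open import Relation.Nullary using (¬_; yes; no)
open import Relation.Nullary.Decidable using (_×-dec_)
open import Relation.Binary.PropositionalEquality using (_≡_; _≢_; refl; sym; trans; cong; cong₂; subst)

private
  variable
    n : ℕ
    C D K : Cond
    u w c : ℕ

factVars : {C : Cond} {a : Atom ℕ} → a ∈ facts C → VarsIn a (vars C)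
factVars {C} = All.lookup (wf C)

idH : (C : Cond) → Hom C C
idH C = hom id id (λ {a} m → subst (_∈ facts C) (sym (mapAtom-id a)) m)

trivialCover : (C : Cond) → Cover C
trivialCover C = leaf C (idH C) (idH C , (λ _ → refl) , (λ _ → refl))

addVar : Cond → ℕ → Cond
addVar C y = cond (y ∷ vars C) (facts C) (All.map (λ {a} → weakenVars {a}) (wf C))
  where
  weakenVars : ∀ {a} → VarsIn a (vars C) → VarsIn a (y ∷ vars C)
  weakenVars {P _}   x∈       = there x∈
  weakenVars {Q _ _} (x∈ , z∈) = there x∈ , there z∈
  weakenVars {R _ _} (x∈ , z∈) = there x∈ , there z∈

addVarHom : (C : Cond) (y : ℕ) → Hom (addVar C y) C
addVarHom C y = hom id there (λ {a} m → subst (_∈ facts C) (sym (mapAtom-id a)) m)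

withP : Cond → ℕ → Cond
withP C y = addFact (addVar C y) (P y) (here refl)

withPHom : (C : Cond) (y : ℕ) → Hom (withP C y) C
withPHom C y = compH (addVarHom C y) incl

identity-rn : (f : Hom D C) → (∀ x → fun f x ≡ x) → Adm-rn f
identity-rn f fx≡x {x} {y} _ _ e = trans (sym (fx≡x x)) (trans e (fx≡x y))

rename : (C : Cond) (σ : ℕ → ℕ) → (∀ {x} → x ∈ vars C → σ x ∈ vars C) → Cond
rename C σ σX =
  cond (vars C) (map (mapAtom σ) (facts C)) (map⁺ (All.map (λ {a} → renameVars {a}) (wf C)))
  where
  renameVars : ∀ {a} → VarsIn a (vars C) → VarsIn (mapAtom σ a) (vars C)
  renameVars {P _}   x∈       = σX x∈
  renameVars {Q _ _} (x∈ , z∈) = σX x∈ , σX z∈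
  renameVars {R _ _} (x∈ , z∈) = σX x∈ , σX z∈

renameHom : (C : Cond) (σ : ℕ → ℕ) (σX : ∀ {x} → x ∈ vars C → σ x ∈ vars C) →
            Hom (rename C σ σX) C
renameHom C σ σX = hom σ σX (∈-map⁺ (mapAtom σ))

fresh : List ℕ → ℕ
fresh xs = suc (max 0 xs)

fresh-∉ : (xs : List ℕ) → fresh xs ∉ xs
fresh-∉ xs m = 1+n≰n (All.lookup (xs≤max 0 xs) m)

-- Every cover has a leaf (U ◁ C is never empty: T has no axiom with empty conclusion).
someLeaf : {Φ : (D : Cond) → Hom D C → Set} (cv : Cover C) →
           AllIn cv Φ → Σ Cond λ D → Σ (Hom D C) (Φ D)
someLeaf (leaf D f _) φf = D , f , φf
someLeaf (split _ _ _ _ _ cvQ _) (φQ , _) with someLeaf cvQ φQ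
... | D , g , φg = D , compH incl g , φg

⊥-unforced : ¬ Σ (Cover C) (λ cv → AllIn cv (λ _ _ → ⊥))
⊥-unforced (cv , allBot) with someLeaf cv allBot
... | _ , _ , ()

-- The formula ∀z. Q(x,z) ∨ R(y,z), for x and y the two innermost bound variables.
allQR : Fm (suc (suc n))
allQR = ∀' (atom (Q (suc (suc zero)) zero) ∨' atom (R (suc zero) zero))

axiom-forced : {Adm : {D C : Cond} → Hom D C → Set} (ρ : Fin (suc (suc n)) → ℕ) →
               P (ρ (suc zero)) ∈ facts C → ρ zero ≡ ρ (suc zero) → Forces Adm C allQR ρ
axiom-forced ρ Px y≡x D h _ t t∈ =
  split x t Px′ (factVars {D} Px′) t∈ (trivialCover _) (trivialCover _) ,
  inj₁ (trivialCover _ , here refl) ,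
  inj₂ (trivialCover _ , here (cong (λ v → R (fun h v) t) y≡x))
  where
  x = fun h (ρ (suc zero))
  Px′ = mapsFacts h Px

merge : ℕ → ℕ → ℕ → ℕ
merge x y z with z ≟ y
... | yes _ = x
... | no  _ = z

merge-y : (x y : ℕ) → merge x y y ≡ x
merge-y x y with y ≟ y
... | yes _   = refl
... | no y≢y = ⊥-elim (y≢y refl)

merge-x : (x y : ℕ) → merge x y x ≡ x
merge-x x y with x ≟ y
... | yes _ = refl
... | no  _ = refl

merge-closed : {X : List ℕ} (x y : ℕ) → x ∈ X → ∀ {z} → z ∈ X → merge x y z ∈ X
merge-closed x y x∈ {z} z∈ with z ≟ y
... | yes _ = x∈
... | no  _ = z∈

-- Over C_vs, ¬∀z.(Q(x,z) ∨ R(y,z)) is never forced: merge y into x and add P(x).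
negation-refuted : (F : Cond) (ρ : Fin (suc (suc n)) → ℕ) → ρ (suc zero) ∈ vars F →
                   ¬ Forces Adm-vs F (¬' allQR) ρ
negation-refuted F ρ x∈ neg =
  ⊥-unforced (neg G (compH (renameHom F σ σX) incl) tt
                  (axiom-forced {Adm = Adm-vs} (σ ∘ ρ) (here refl) σy≡σx))
  where
  x = ρ (suc zero)
  y = ρ zero
  σ = merge x y
  σX : ∀ {z} → z ∈ vars F → σ z ∈ vars F
  σX = merge-closed x y x∈
  σy≡σx : σ y ≡ σ x
  σy≡σx = trans (merge-y x y) (sym (merge-x x y))
  G : Cond
  G = addFact (rename F σ σX) (P (σ x)) (σX x∈)

-- Part 1: descend to a leaf carrying both witnesses of φ and refute its negated conjunct.
forces-vs-¬φ : (C : Cond) → C ⊩vs ¬' φ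
forces-vs-¬φ C D f _ (cv , forcesφ) with someLeaf cv forcesφ
... | _ , g , x , x∈ , (cv′ , forcesφ′) with someLeaf cv′ forcesφ′
... | F , g′ , y , _ , _ , _ , neg =
  ⊥-elim (negation-refuted {n = 0} F (ext y (fun g′ ∘ ext x (fun g ∘ fun f ∘ λ ())))
                            (mapsVars g′ x∈) neg)

record Undecided (K : Cond) (u w c : ℕ) : Set where
  field
    u∈  : u ∈ vars K
    w∈  : w ∈ vars K
    c∈  : c ∈ vars K
    u≢w : u ≢ w
    Q∉  : Q u c ∉ facts K
    R∉  : R w c ∉ facts K

undecided-iso : (f : Hom D K) → IsIso f → Undecided K u w c →
                Undecided D (fun f u) (fun f w) (fun f c)
undecided-iso {K = K} f (g , gf , _) und = record
  { u∈  = mapsVars f u∈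
  ; w∈  = mapsVars f w∈
  ; c∈  = mapsVars f c∈
  ; u≢w = λ e → u≢w (trans (sym (gf u∈)) (trans (cong (fun g) e) (gf w∈)))
  ; Q∉  = λ m → Q∉ (subst (_∈ facts K) (cong₂ Q (gf u∈) (gf c∈)) (mapsFacts g m))
  ; R∉  = λ m → R∉ (subst (_∈ facts K) (cong₂ R (gf w∈) (gf c∈)) (mapsFacts g m))
  }
  where open Undecided und

undecided-add : {α : Atom ℕ} {p : VarsIn α (vars K)} → Undecided K u w c →
                Q u c ≢ α → R w c ≢ α → Undecided (addFact K α p) u w c
undecided-add und Q≢α R≢α = record
  { u∈ = u∈ ; w∈ = w∈ ; c∈ = c∈ ; u≢w = u≢w
  ; Q∉ = λ { (here e) → Q≢α e ; (there m) → Q∉ m }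
  ; R∉ = λ { (here e) → R≢α e ; (there m) → R∉ m }
  }
  where open Undecided und

-- Every cover of an undecided K has a leaf at which the pair is still undecided:
-- at a split on (a,b) take the Q-branch unless Q(a,b) = Q(u,c), else the R-branch.
undecidedLeaf : {Φ : (D : Cond) → Hom D K → Set} (cv : Cover K) →
                AllIn cv Φ → Undecided K u w c →
                Σ Cond λ D → Σ (Hom D K) λ f → Φ D f × Undecided D (fun f u) (fun f w) (fun f c)
undecidedLeaf (leaf D f iso) φf und = D , f , φf , undecided-iso f iso und
undecidedLeaf {u = u} {c = c} (split a b _ _ _ cvQ cvR) (φQ , φR) und with a ≟ u ×-dec b ≟ c
... | yes (refl , refl)
  with undecidedLeaf cvR φR (undecided-add und (λ ()) (λ { refl → Undecided.u≢w und refl }))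
... | D , g , φg , und′ = D , compH incl g , φg , und′
undecidedLeaf {u = u} {c = c} (split a b _ _ _ cvQ cvR) (φQ , φR) und | no ab≢uc
  with undecidedLeaf cvQ φQ (undecided-add und (λ { refl → ab≢uc (refl , refl) }) (λ ()))
... | D , g , φg , und′ = D , compH incl g , φg , und′

undecided-Q-unforced : Undecided K u w c →
                       ¬ Σ (Cover K) (λ cv → AllIn cv (λ D f → Q (fun f u) (fun f c) ∈ facts D))
undecided-Q-unforced und (cv , allQ) with undecidedLeaf cv allQ und
... | _ , _ , Q∈ , und′ = Undecided.Q∉ und′ Q∈

undecided-R-unforced : Undecided K u w c →
                       ¬ Σ (Cover K) (λ cv → AllIn cv (λ D f → R (fun f w) (fun f c) ∈ facts D))
undecided-R-unforced und (cv , allR) with undecidedLeaf cv allR und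
... | _ , _ , R∈ , und′ = Undecided.R∉ und′ R∈

fresh-undecided : (H : Cond) {x y : ℕ} → x ∈ vars H → y ∈ vars H → x ≢ y →
                  Undecided (addVar H (fresh (vars H))) x y (fresh (vars H))
fresh-undecided H x∈ y∈ x≢y = record
  { u∈ = there x∈ ; w∈ = there y∈ ; c∈ = here refl ; u≢w = x≢y
  ; Q∉ = λ m → fresh-∉ (vars H) (proj₂ (factVars {H} m))
  ; R∉ = λ m → fresh-∉ (vars H) (proj₂ (factVars {H} m))
  }

-- For x ≠ y, ∀z.(Q(x,z) ∨ R(y,z)) is not forced over C_rn: instantiated at a
-- fresh variable, the disjunction has a leaf where neither disjunct can be forced.
allQR-unforced : (H : Cond) (ρ : Fin (suc (suc n)) → ℕ) →
                 ρ (suc zero) ∈ vars H → ρ zero ∈ vars H → ρ (suc zero) ≢ ρ zero →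
                 ¬ Forces Adm-rn H allQR ρ
allQR-unforced H ρ x∈ y∈ x≢y forcesAll
  with forcesAll (addVar H (fresh (vars H))) (addVarHom H (fresh (vars H)))
                 (identity-rn (addVarHom H (fresh (vars H))) (λ _ → refl))
                 (fresh (vars H)) (here refl)
... | cv , disjunction with undecidedLeaf cv disjunction (fresh-undecided H x∈ y∈ x≢y)
... | _ , _ , inj₁ forcesQ , und = undecided-Q-unforced und forcesQ
... | _ , _ , inj₂ forcesR , und = undecided-R-unforced und forcesR

-- Over C_rn, a condition with two distinct P-facts P(a), P(b) forces φ, witnessed
-- by x := a, y := b: injective extensions keep a and b apart, so ¬∀z.(…) holds.
φ-forced : (E : Cond) {a b : ℕ} → P a ∈ facts E → P b ∈ facts E → a ≢ b →
           (ρ : Fin 0 → ℕ) → Forces Adm-rn E φ ρ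
φ-forced E {a} {b} Pa Pb a≢b ρ =
  trivialCover E , a , a∈ , trivialCover E , b , b∈ ,
  (trivialCover E , Pa) , (trivialCover E , Pb) , noAll
  where
  a∈ = factVars {E} Pa
  b∈ = factVars {E} Pb
  noAll : (H : Cond) (h : Hom H E) → Adm-rn h →
          Forces Adm-rn H allQR (fun h ∘ ext b (ext a ρ)) →
          Forces Adm-rn H ⊥' (fun h ∘ ext b (ext a ρ))
  noAll H h h-rn forcesAll =
    ⊥-elim (allQR-unforced H (fun h ∘ ext b (ext a ρ)) (mapsVars h a∈) (mapsVars h b∈)
                           (λ e → a≢b (h-rn a∈ b∈ e)) forcesAll)

-- Part 2: any extension D forcing ¬φ extends injectively to a condition forcing φ.
forces-rn-¬¬φ : (C : Cond) → C ⊩rn ¬' (¬' φ)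
forces-rn-¬¬φ C D f _ forces¬φ =
  ⊥-elim (⊥-unforced (forces¬φ E e (identity-rn e (λ _ → refl))
                                (φ-forced E (there (here refl)) (here refl) (λ ()) (λ ()))))
  where
  -- D extended by the variables 0, 1 and the facts P(0), P(1); 0 ≠ 1 is all φ needs.
  E : Cond
  E = withP (withP D 0) 1
  e : Hom E D
  e = compH (withPHom D 0) (withPHom (withP D 0) 1)

lemma6p4 : ((C : Cond) → C ⊩vs ¬' φ) × ((C : Cond) → C ⊩rn ¬' (¬' φ))
lemma6p4 = forces-vs-¬φ , forces-rn-¬¬φ
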